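{- Let $L$ be a list-assignment of a graph $G$ such that for every vertex $v$ of $G$, $$|L(v)|\;\geq\;4\sum_{w\in N_G(v)}\frac{|L(v)\cap L(w)|}{|L(w)|}.$$ Then there exist at least $\prod_{v\in V(G)}\frac{|L(v)|}{2}$ proper $L$-colourings of $G$.
   Context: Graphs are finite and simple; $N_G(v)$ is the set of neighbours of $v$. A list-assignment $L$ assigns each vertex $v$ a finite nonempty set $L(v)$ of colours. An $L$-colouring is a function $\phi$ with $\phi(v)\in L(v)$ for all $v$; it is proper if adjacent vertices receive different colours. -}

module Defs where

open import Data.Nat as ℕ using (ℕ; zero; suc)
open import Data.Integer using (+_)
open import Data.Rational using (ℚ; 0ℚ; 1ℚ; _/_; _+_; _*_)
open import Data.Fin using (Fin)
open import Data.List using (List; []; _∷_; length; filter; foldr; map)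
open import Data.List.Relation.Unary.Unique.Propositional using (Unique)
open import Data.List.Relation.Unary.AllPairs using (AllPairs)
open import Data.List.Membership.Propositional using (_∈_)
open import Data.List.Membership.DecPropositional ℕ._≟_ using (_∈?_)
open import Data.Fin.Base using ()
open import Data.List using (allFin)
open import Data.Bool using (Bool; true; false; if_then_else_)
open import Relation.Binary.PropositionalEquality using (_≡_; _≢_)
open import Relation.Nullary using (¬_)

record Graph (n : ℕ) : Set where
  field
    adj   : Fin n → Fin n → Bool
    sym   : ∀ v w → adj v w ≡ adj w v
    irrefl : ∀ v → adj v v ≡ false
open Graph public

record ListAssignment (n : ℕ) : Set where
  field
    L        : Fin n → List ℕ
    unique   : ∀ v → Unique (L v)
    nonempty : ∀ v → L v ≢ []
open ListAssignment public

card : List ℕ → ℕ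
card = length

card∩ : List ℕ → List ℕ → ℕ
card∩ A B = length (filter (_∈? B) A)

-- a / b as a rational (b is never 0 where used, since lists are nonempty)
frac : ℕ → ℕ → ℚ
frac a zero    = 0ℚ
frac a (suc b) = (+ a) / suc b

sumNbrs : ∀ {n} → Graph n → Fin n → (Fin n → ℚ) → ℚ
sumNbrs G v f = foldr (λ w acc → if adj G v w then f w + acc else acc) 0ℚ (allFin _)

prodV : ∀ {n} → (Fin n → ℚ) → ℚ
prodV {n} f = foldr (λ v acc → f v * acc) 1ℚ (allFin n)

IsLColouring : ∀ {n} → ListAssignment n → (Fin n → ℕ) → Set
IsLColouring La φ = ∀ v → φ v ∈ L La v

IsProper : ∀ {n} → Graph n → (Fin n → ℕ) → Set
IsProper G φ = ∀ v w → adj G v w ≡ true → φ v ≢ φ w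

Distinct : ∀ {n} → (Fin n → ℕ) → (Fin n → ℕ) → Set
Distinct φ ψ = ¬ (∀ v → φ v ≡ ψ v)

module Submission where

-- Write P(S) for the number of proper L-colourings of G[S]. The key claim is |L(v)| P(S) ≤ 2 P(S ∪ {v})
-- for v ∉ S, by induction on |S|. Of the |L(v)| P(S) extensions of a proper colouring of S by a colour
-- c ∈ L(v), the improper ones give some neighbour u ∈ S the colour c; for fixed u there are at most
-- |L(v) ∩ L(u)| P(S − u) ≤ 2 P(S) |L(v) ∩ L(u)| / |L(u)| of them by induction, so by the hypothesis at most
-- |L(v)| P(S) / 2 in all. Adding the vertices one at a time gives P(V) ≥ ∏ |L(v)| / 2.
-- Vertex sets are duplicate-free lists, so P must be shown invariant under permuting the list in order
-- to bring the neighbour u to the front.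

open import Defs hiding (sym)
open import Algebra.Bundles using (CommutativeMonoid)
import Algebra.Properties.CommutativeSemigroup as CommutativeSemigroupₚ
open import Data.Bool using (true; false; if_then_else_)
import Data.Bool.Properties as Boolₚ
open import Data.Empty using (⊥-elim)
open import Data.Fin as Fin using (Fin)
import Data.Fin.Properties as Finₚ
open import Data.Integer as ℤ using (+_)
import Data.Integer.Properties as ℤₚ
open import Data.List using (List; []; _∷_; _++_; map; concatMap; filter; length; foldr; allFin)
import Data.List.Properties as Listₚ
open import Data.List.Membership.Propositional using (_∈_; _∉_)
import Data.List.Membership.Propositional.Properties as Membershipₚ
open import Data.List.Relation.Binary.Permutation.Propositional as ↭ using (_↭_)
import Data.List.Relation.Binary.Permutation.Propositional.Properties as Permₚ
open import Data.List.Relation.Unary.All as All using (All; []; _∷_)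
import Data.List.Relation.Unary.All.Properties as Allₚ
open import Data.List.Relation.Unary.AllPairs using (AllPairs; []; _∷_)
import Data.List.Relation.Unary.AllPairs as AllPairs
import Data.List.Relation.Unary.AllPairs.Properties as AllPairsₚ
open import Data.List.Relation.Unary.Any using (here; there)
open import Data.List.Relation.Unary.Unique.Propositional using (Unique)
import Data.List.Relation.Unary.Unique.Propositional.Properties as Uniqueₚ
open import Data.Nat as ℕ using (ℕ; zero; suc; _+_; _*_; _≤_; z≤n; s≤s)
import Data.Nat.Properties as ℕₚ
open import Data.Nat.Tactic.RingSolver using (solve-∀)
open import Data.Product using (Σ; _×_; _,_)
open import Data.Rational as ℚ using (ℚ; 0ℚ; 1ℚ; _/_; toℚᵘ)
import Data.Rational.Properties as ℚₚ
open import Data.Rational.Unnormalised as ℚᵘ using (mkℚᵘ)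
import Data.Rational.Unnormalised.Properties as ℚᵘₚ
open import Data.Vec.Functional using (Vector; updateAt)
open import Data.Vec.Functional.Properties using (updateAt-updates; updateAt-minimal; updateAt-commutes)
open import Function using (_∘_; const)
open import Function.Definitions using (Congruent)
open import Relation.Binary using (DecidableEquality)
open import Relation.Binary.PropositionalEquality
open import Relation.Nullary using (Dec; yes; no; ¬_; ¬?)
open import Relation.Nullary.Decidable using (map′; _×-dec_; _→-dec_)
open import Relation.Unary using (Decidable)

-- Finite sums

infix 2 ∑
∑ : {A : Set} → List A → (A → ℕ) → ℕ
∑ []       f = 0
∑ (x ∷ xs) f = f x + ∑ xs f

syntax ∑ xs (λ x → e) = ∑[ x ∈ xs ] e

module _ {A : Set} where

  ∑-cong : ∀ {f g : A → ℕ} → (∀ x → f x ≡ g x) → ∀ xs → ∑ xs f ≡ ∑ xs g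
  ∑-cong f≗g []       = refl
  ∑-cong f≗g (x ∷ xs) = cong₂ _+_ (f≗g x) (∑-cong f≗g xs)

  ∑-mono : ∀ {f g : A → ℕ} → (∀ x → f x ≤ g x) → ∀ xs → ∑ xs f ≤ ∑ xs g
  ∑-mono f≤g []       = z≤n
  ∑-mono f≤g (x ∷ xs) = ℕₚ.+-mono-≤ (f≤g x) (∑-mono f≤g xs)

  ∑-++ : ∀ (f : A → ℕ) xs ys → ∑ (xs ++ ys) f ≡ ∑ xs f + ∑ ys f
  ∑-++ f []       ys = refl
  ∑-++ f (x ∷ xs) ys = trans (cong (_+_ (f x)) (∑-++ f xs ys)) (sym (ℕₚ.+-assoc (f x) _ _))

  ∑-+ : ∀ (f g : A → ℕ) xs → (∑[ x ∈ xs ] f x + g x) ≡ ∑ xs f + ∑ xs g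
  ∑-+ f g []       = refl
  ∑-+ f g (x ∷ xs) = trans (cong (_+_ (f x + g x)) (∑-+ f g xs)) (+-interchange (f x) (g x) _ _)
    where
    +-interchange : ∀ a b c d → a + b + (c + d) ≡ a + c + (b + d)
    +-interchange = solve-∀

  ∑-*ˡ : ∀ k (f : A → ℕ) xs → (∑[ x ∈ xs ] k * f x) ≡ k * ∑ xs f
  ∑-*ˡ k f []       = sym (ℕₚ.*-zeroʳ k)
  ∑-*ˡ k f (x ∷ xs) = trans (cong (_+_ (k * f x)) (∑-*ˡ k f xs)) (sym (ℕₚ.*-distribˡ-+ k (f x) _))

  ∑-*ʳ : ∀ k (f : A → ℕ) xs → (∑[ x ∈ xs ] f x * k) ≡ ∑ xs f * k
  ∑-*ʳ k f xs = begin
    (∑[ x ∈ xs ] f x * k) ≡⟨ ∑-cong (λ x → ℕₚ.*-comm (f x) k) xs ⟩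
    (∑[ x ∈ xs ] k * f x) ≡⟨ ∑-*ˡ k f xs ⟩
    k * ∑ xs f            ≡⟨ ℕₚ.*-comm k _ ⟩
    ∑ xs f * k            ∎
    where open ≡-Reasoning

  ∑-const : ∀ k (xs : List A) → ∑ xs (const k) ≡ length xs * k
  ∑-const k []       = refl
  ∑-const k (x ∷ xs) = cong (_+_ k) (∑-const k xs)

  ∑-≥-∈ : ∀ (f : A → ℕ) {x xs} → x ∈ xs → f x ≤ ∑ xs f
  ∑-≥-∈ f (here refl) = ℕₚ.m≤m+n _ _
  ∑-≥-∈ f {xs = y ∷ _} (there x∈xs) = ℕₚ.≤-trans (∑-≥-∈ f x∈xs) (ℕₚ.m≤n+m _ (f y))

  ∑-if : ∀ b (f : A → ℕ) xs → (∑[ x ∈ xs ] (if b then f x else 0)) ≡ (if b then ∑ xs f else 0)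
  ∑-if true  f xs = refl
  ∑-if false f xs = trans (∑-const 0 xs) (ℕₚ.*-zeroʳ (length xs))

∑-map : ∀ {A B : Set} (f : B → ℕ) (h : A → B) xs → ∑ (map h xs) f ≡ (∑[ x ∈ xs ] f (h x))
∑-map f h []       = refl
∑-map f h (x ∷ xs) = cong (_+_ (f (h x))) (∑-map f h xs)

∑-concatMap : ∀ {A B : Set} (f : B → ℕ) (h : A → List B) xs →
              ∑ (concatMap h xs) f ≡ (∑[ x ∈ xs ] ∑ (h x) f)
∑-concatMap f h []       = refl
∑-concatMap f h (x ∷ xs) = trans (∑-++ f (h x) (concatMap h xs)) (cong (_+_ (∑ (h x) f)) (∑-concatMap f h xs))

∑-comm : ∀ {A B : Set} (h : A → B → ℕ) xs ys →
         (∑[ x ∈ xs ] ∑[ y ∈ ys ] h x y) ≡ (∑[ y ∈ ys ] ∑[ x ∈ xs ] h x y)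
∑-comm h []       ys = sym (trans (∑-const 0 ys) (ℕₚ.*-zeroʳ (length ys)))
∑-comm h (x ∷ xs) ys = trans (cong (_+_ (∑ ys (h x))) (∑-comm h xs ys)) (sym (∑-+ (h x) _ ys))

-- Indicators of decidable propositions

⟦_⟧ : {P : Set} → Dec P → ℕ
⟦ yes _ ⟧ = 1
⟦ no _ ⟧  = 0

⟦⟧-mono : ∀ {P Q : Set} → (P → Q) → (p? : Dec P) (q? : Dec Q) → ⟦ p? ⟧ ≤ ⟦ q? ⟧
⟦⟧-mono P⇒Q (yes p) (yes q)  = s≤s z≤n
⟦⟧-mono P⇒Q (yes p) (no ¬q)  = ⊥-elim (¬q (P⇒Q p))
⟦⟧-mono P⇒Q (no ¬p) q?       = z≤n

⟦⟧-cong : ∀ {P Q : Set} → (P → Q) → (Q → P) → (p? : Dec P) (q? : Dec Q) → ⟦ p? ⟧ ≡ ⟦ q? ⟧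
⟦⟧-cong P⇒Q Q⇒P p? q? = ℕₚ.≤-antisym (⟦⟧-mono P⇒Q p? q?) (⟦⟧-mono Q⇒P q? p?)

module _ {P : Set} where

  ⟦⟧-yes : (p? : Dec P) → P → ⟦ p? ⟧ ≡ 1
  ⟦⟧-yes (yes _) p = refl
  ⟦⟧-yes (no ¬p) p = ⊥-elim (¬p p)

  ⟦⟧-no : (p? : Dec P) → ¬ P → ⟦ p? ⟧ ≡ 0
  ⟦⟧-no (yes p) ¬p = ⊥-elim (¬p p)
  ⟦⟧-no (no _)  ¬p = refl

  ⟦⟧-*-mono : ∀ {a b} → (P → a ≤ b) → (p? : Dec P) → ⟦ p? ⟧ * a ≤ ⟦ p? ⟧ * b
  ⟦⟧-*-mono a≤b (yes p) = ℕₚ.*-monoʳ-≤ 1 (a≤b p)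
  ⟦⟧-*-mono a≤b (no _)  = z≤n

  ⟦⟧-*-≤ : ∀ {a b} → (P → a ≤ b) → (p? : Dec P) → ⟦ p? ⟧ * a ≤ b
  ⟦⟧-*-≤ a≤b (yes p) = subst (_≤ _) (sym (ℕₚ.*-identityˡ _)) (a≤b p)
  ⟦⟧-*-≤ a≤b (no _)  = z≤n

length-filter : ∀ {A : Set} {P : A → Set} (P? : Decidable P) xs →
                length (filter P? xs) ≡ (∑[ x ∈ xs ] ⟦ P? x ⟧)
length-filter P? []       = refl
length-filter P? (x ∷ xs) with P? x
... | yes _ = cong suc (length-filter P? xs)
... | no _  = length-filter P? xs

module _ {A : Set} (_≟_ : DecidableEquality A) where
  open import Data.List.Membership.DecPropositional _≟_ using () renaming (_∈?_ to _∈ₐ?_)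

  ∑-⟦≟⟧-∉ : ∀ {a} xs → a ∉ xs → (∑[ x ∈ xs ] ⟦ x ≟ a ⟧) ≡ 0
  ∑-⟦≟⟧-∉ []       a∉xs = refl
  ∑-⟦≟⟧-∉ (x ∷ xs) a∉xs =
    cong₂ _+_ (⟦⟧-no (x ≟ _) (λ x≡a → a∉xs (here (sym x≡a)))) (∑-⟦≟⟧-∉ xs (a∉xs ∘ there))

  ∑-⟦≟⟧-unique : ∀ a {xs} → Unique xs → (∑[ x ∈ xs ] ⟦ x ≟ a ⟧) ≡ ⟦ a ∈ₐ? xs ⟧
  ∑-⟦≟⟧-unique a {[]}     []             = refl
  ∑-⟦≟⟧-unique a {x ∷ xs} (x∉xs ∷ uniq) with x ≟ a
  ... | yes refl = sym (trans (⟦⟧-yes (a ∈ₐ? (a ∷ xs)) (here refl))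
                              (cong suc (sym (∑-⟦≟⟧-∉ xs (Uniqueₚ.Unique[x∷xs]⇒x∉xs (x∉xs ∷ uniq))))))
  ... | no x≢a  = trans (∑-⟦≟⟧-unique a uniq) (⟦⟧-cong there ∈-tail (a ∈ₐ? xs) (a ∈ₐ? (x ∷ xs)))
    where
    ∈-tail : a ∈ x ∷ xs → a ∈ xs
    ∈-tail (here a≡x)  = ⊥-elim (x≢a (sym a≡x))
    ∈-tail (there a∈xs) = a∈xs

card∩-∑ : ∀ A {B} → Unique B → card∩ A B ≡ (∑[ a ∈ A ] ∑[ b ∈ B ] ⟦ b ℕ.≟ a ⟧)
card∩-∑ A uniq = trans (length-filter _ A) (∑-cong (λ a → sym (∑-⟦≟⟧-unique ℕ._≟_ a uniq)) A)

mp≤y⇒pam≤ya : ∀ m p a {y} → m * p ≤ y → p * a * m ≤ y * a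
mp≤y⇒pam≤ya m p a {y} mp≤y = subst (_≤ y * a) (rearrange m p a) (ℕₚ.*-monoˡ-≤ a mp≤y)
  where
  rearrange : ∀ m p a → m * p * a ≡ p * a * m
  rearrange = solve-∀

a≤p+b∧2b≤a⇒a≤2p : ∀ a p b → a ≤ p + b → 2 * b ≤ a → a ≤ 2 * p
a≤p+b∧2b≤a⇒a≤2p a p b a≤p+b 2b≤a = ℕₚ.+-cancelʳ-≤ a a (2 * p) (begin
  a + a             ≤⟨ ℕₚ.+-mono-≤ a≤p+b a≤p+b ⟩
  (p + b) + (p + b) ≡⟨ rearrange p b ⟩
  2 * p + 2 * b     ≤⟨ ℕₚ.+-monoʳ-≤ (2 * p) 2b≤a ⟩
  2 * p + a         ∎)
  where
  open ℕₚ.≤-Reasoning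
  rearrange : ∀ p b → (p + b) + (p + b) ≡ 2 * p + 2 * b
  rearrange = solve-∀

-- Natural numbers inside ℚ

fromℕ : ℕ → ℚ
fromℕ k = + k / 1

fromℕ-nonNeg : ∀ k → ℚ.NonNegative (fromℕ k)
fromℕ-nonNeg k = ℚₚ.normalize-nonNeg k 1

toℚᵘ-/ : ∀ a b → toℚᵘ (+ a / suc b) ℚᵘ.≃ mkℚᵘ (+ a) b
toℚᵘ-/ a b = ℚₚ.toℚᵘ-fromℚᵘ (mkℚᵘ (+ a) b)

/-mono-≤ : ∀ {a b c d} → a * suc d ≤ c * suc b → + a / suc b ℚ.≤ + c / suc d
/-mono-≤ {a} {b} {c} {d} ad≤cb = ℚₚ.toℚᵘ-cancel-≤
  (ℚᵘₚ.≤-respʳ-≃ (ℚᵘₚ.≃-sym (toℚᵘ-/ c d)) (ℚᵘₚ.≤-respˡ-≃ (ℚᵘₚ.≃-sym (toℚᵘ-/ a b)) (ℚᵘ.*≤* ad≤cbᶻ)))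
  where
  ad≤cbᶻ : + a ℤ.* + suc d ℤ.≤ + c ℤ.* + suc b
  ad≤cbᶻ = subst₂ ℤ._≤_ (ℤₚ.pos-* a (suc d)) (ℤₚ.pos-* c (suc b)) (ℤ.+≤+ ad≤cb)

/-cancel-≤ : ∀ {a b c d} → + a / suc b ℚ.≤ + c / suc d → a * suc d ≤ c * suc b
/-cancel-≤ {a} {b} {c} {d} a/b≤c/d with ℚᵘ.*≤* ad≤cbᶻ ←
  ℚᵘₚ.≤-respʳ-≃ (toℚᵘ-/ c d) (ℚᵘₚ.≤-respˡ-≃ (toℚᵘ-/ a b) (ℚₚ.toℚᵘ-mono-≤ a/b≤c/d))
  = ℤₚ.drop‿+≤+ (subst₂ ℤ._≤_ (sym (ℤₚ.pos-* a (suc d))) (sym (ℤₚ.pos-* c (suc b))) ad≤cbᶻ)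

/-* : ∀ a b c d → (+ a / suc b) ℚ.* (+ c / suc d) ≡ + (a * c) / (suc b * suc d)
/-* a b c d = ℚₚ.toℚᵘ-injective (begin
  toℚᵘ ((+ a / suc b) ℚ.* (+ c / suc d))       ≈⟨ ℚₚ.toℚᵘ-homo-* (+ a / suc b) (+ c / suc d) ⟩
  toℚᵘ (+ a / suc b) ℚᵘ.* toℚᵘ (+ c / suc d)   ≈⟨ ℚᵘₚ.*-cong (toℚᵘ-/ a b) (toℚᵘ-/ c d) ⟩
  mkℚᵘ (+ a ℤ.* + c) (d + b * suc d)            ≡⟨ cong (λ z → mkℚᵘ z _) (sym (ℤₚ.pos-* a c)) ⟩
  mkℚᵘ (+ (a * c)) (d + b * suc d)              ≈⟨ ℚᵘₚ.≃-sym (toℚᵘ-/ (a * c) _) ⟩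
  toℚᵘ (+ (a * c) / (suc b * suc d))            ∎)
  where open ℚᵘₚ.≃-Reasoning

fromℕ-+ : ∀ a b → fromℕ (a + b) ≡ fromℕ a ℚ.+ fromℕ b
fromℕ-+ a b = ℚₚ.toℚᵘ-injective (begin
  toℚᵘ (fromℕ (a + b))                         ≈⟨ toℚᵘ-/ (a + b) 0 ⟩
  mkℚᵘ (+ (a + b)) 0                           ≡⟨ cong (λ z → mkℚᵘ z 0) sum-as-ℤ ⟩
  mkℚᵘ (+ a ℤ.* + 1 ℤ.+ + b ℤ.* + 1) 0          ≈⟨ ℚᵘₚ.+-cong (ℚᵘₚ.≃-sym (toℚᵘ-/ a 0)) (ℚᵘₚ.≃-sym (toℚᵘ-/ b 0)) ⟩
  toℚᵘ (fromℕ a) ℚᵘ.+ toℚᵘ (fromℕ b)           ≈⟨ ℚᵘₚ.≃-sym (ℚₚ.toℚᵘ-homo-+ (fromℕ a) (fromℕ b)) ⟩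
  toℚᵘ (fromℕ a ℚ.+ fromℕ b)                   ∎)
  where
  open ℚᵘₚ.≃-Reasoning
  sum-as-ℤ : + (a + b) ≡ + a ℤ.* + 1 ℤ.+ + b ℤ.* + 1
  sum-as-ℤ = trans (ℤₚ.pos-+ a b) (sym (cong₂ ℤ._+_ (ℤₚ.*-identityʳ (+ a)) (ℤₚ.*-identityʳ (+ b))))

fromℕ-* : ∀ a b → fromℕ (a * b) ≡ fromℕ a ℚ.* fromℕ b
fromℕ-* a b = sym (/-* a 0 b 0)

fromℕ-cancel-≤ : ∀ {a b} → fromℕ a ℚ.≤ fromℕ b → a ≤ b
fromℕ-cancel-≤ {a} {b} a≤b = subst₂ _≤_ (ℕₚ.*-identityʳ a) (ℕₚ.*-identityʳ b) (/-cancel-≤ {a} {0} {b} {0} a≤b)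

fromℕ-≤-*frac : ∀ t a m y → m ≢ 0 → t * m ≤ y * a → fromℕ t ℚ.≤ fromℕ y ℚ.* frac a m
fromℕ-≤-*frac t a zero    y m≢0 _ = ⊥-elim (m≢0 refl)
fromℕ-≤-*frac t a (suc m) y _ tm≤ya =
  subst (fromℕ t ℚ.≤_) (sym (/-* y 0 a m)) (/-mono-≤ {t} {0} {y * a} {m + 0} (begin
  t * suc (m + 0) ≡⟨ cong (λ k → t * suc k) (ℕₚ.+-identityʳ m) ⟩
  t * suc m       ≤⟨ tm≤ya ⟩
  y * a           ≡⟨ sym (ℕₚ.*-identityʳ _) ⟩
  y * a * 1       ∎))
  where open ℕₚ.≤-Reasoning

frac/2-*-≤ : ∀ l x s → l * x ≤ 2 * s → frac l 2 ℚ.* fromℕ x ℚ.≤ fromℕ s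
frac/2-*-≤ l x s lx≤2s = subst (ℚ._≤ fromℕ s) (sym (/-* l 1 x 0)) (/-mono-≤ {l * x} {1} {s} {0} (begin
  l * x * 1 ≡⟨ ℕₚ.*-identityʳ _ ⟩
  l * x     ≤⟨ lx≤2s ⟩
  2 * s     ≡⟨ ℕₚ.*-comm 2 s ⟩
  s * 2     ∎))
  where open ℕₚ.≤-Reasoning

module Neighbourhoods {n} (G : Graph n) where

  ∑Nbrs : Fin n → (Fin n → ℕ) → ℕ
  ∑Nbrs v t = ∑[ u ∈ allFin n ] (if adj G v u then t u else 0)

  ∑Nbrs-cong : ∀ v {t s} → (∀ u → t u ≡ s u) → ∑Nbrs v t ≡ ∑Nbrs v s
  ∑Nbrs-cong v t≗s = ∑-cong (λ u → cong (if adj G v u then_else 0) (t≗s u)) (allFin n)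

  ∑Nbrs-mono : ∀ v {t s} → (∀ u → adj G v u ≡ true → t u ≤ s u) → ∑Nbrs v t ≤ ∑Nbrs v s
  ∑Nbrs-mono v t≤s = ∑-mono pointwise (allFin n)
    where
    pointwise : ∀ u → (if adj G v u then _ else 0) ≤ (if adj G v u then _ else 0)
    pointwise u with adj G v u in vu
    ... | true  = t≤s u vu
    ... | false = z≤n

  ∑Nbrs-≥ : ∀ {v u} t → adj G v u ≡ true → t u ≤ ∑Nbrs v t
  ∑Nbrs-≥ {v} {u} t vu = subst (_≤ ∑Nbrs v t) (cong (if_then t u else 0) vu)
    (∑-≥-∈ (λ w → if adj G v w then t w else 0) (Membershipₚ.∈-allFin u))

  ∑-∑Nbrs : ∀ {A : Set} v (h : A → Fin n → ℕ) xs → (∑[ x ∈ xs ] ∑Nbrs v (h x)) ≡ ∑Nbrs v (λ u → ∑[ x ∈ xs ] h x u)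
  ∑-∑Nbrs v h xs = trans (∑-comm (λ x u → if adj G v u then h x u else 0) xs (allFin n))
                         (∑-cong (λ u → ∑-if (adj G v u) (λ x → h x u) xs) (allFin n))

  fromℕ-∑Nbrs-≤ : ∀ v t (F : Fin n → ℚ) y → (∀ u → adj G v u ≡ true → fromℕ (t u) ℚ.≤ fromℕ y ℚ.* F u) →
                  fromℕ (∑Nbrs v t) ℚ.≤ fromℕ y ℚ.* sumNbrs G v F
  fromℕ-∑Nbrs-≤ v t F y t≤yF = go (allFin n)
    where
    go : ∀ us → fromℕ (∑[ u ∈ us ] (if adj G v u then t u else 0))
                ℚ.≤ fromℕ y ℚ.* foldr (λ w acc → if adj G v w then F w ℚ.+ acc else acc) 0ℚ us
    go []       = ℚₚ.≤-reflexive (sym (ℚₚ.*-zeroʳ (fromℕ y)))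
    go (u ∷ us) with adj G v u in vu
    ... | true  = subst₂ ℚ._≤_ (sym (fromℕ-+ (t u) _)) (sym (ℚₚ.*-distribˡ-+ (fromℕ y) (F u) _))
                          (ℚₚ.+-mono-≤ (t≤yF u vu) (go us))
    ... | false = go us

  ∑Nbrs-bound : ∀ v t (F : Fin n → ℚ) {k y l} → (∀ u → adj G v u ≡ true → fromℕ (t u) ℚ.≤ fromℕ y ℚ.* F u) →
                fromℕ k ℚ.* sumNbrs G v F ℚ.≤ fromℕ l → k * ∑Nbrs v t ≤ y * l
  ∑Nbrs-bound v t F {k} {y} {l} t≤yF kF≤l = fromℕ-cancel-≤ (begin
    fromℕ (k * B)                ≡⟨ fromℕ-* k B ⟩
    fromℕ k ℚ.* fromℕ B          ≤⟨ ℚₚ.*-monoˡ-≤-nonNeg (fromℕ k) {{fromℕ-nonNeg k}} (fromℕ-∑Nbrs-≤ v t F y t≤yF) ⟩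
    fromℕ k ℚ.* (fromℕ y ℚ.* S)  ≡⟨ x∙yz≈y∙xz (fromℕ k) (fromℕ y) S ⟩
    fromℕ y ℚ.* (fromℕ k ℚ.* S)  ≤⟨ ℚₚ.*-monoˡ-≤-nonNeg (fromℕ y) {{fromℕ-nonNeg y}} kF≤l ⟩
    fromℕ y ℚ.* fromℕ l          ≡⟨ fromℕ-* y l ⟨
    fromℕ (y * l)                ∎)
    where
    open ℚₚ.≤-Reasoning
    B : ℕ
    B = ∑Nbrs v t
    S : ℚ
    S = sumNbrs G v F
    open CommutativeSemigroupₚ (CommutativeMonoid.commutativeSemigroup ℚₚ.*-1-commutativeMonoid) using (x∙yz≈y∙xz)

module Colourings {n} (La : ListAssignment n) where

  _[_↦_] : Vector ℕ n → Fin n → ℕ → Vector ℕ n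
  φ [ v ↦ c ] = updateAt φ v (const c)

  ↦-cong : ∀ {φ ψ} v c → φ ≗ ψ → φ [ v ↦ c ] ≗ ψ [ v ↦ c ]
  ↦-cong {φ} {ψ} v c φ≗ψ u with u Fin.≟ v
  ... | yes refl = trans (updateAt-updates v φ) (sym (updateAt-updates v ψ))
  ... | no u≢v   = trans (updateAt-minimal u v φ u≢v) (trans (φ≗ψ u) (sym (updateAt-minimal u v ψ u≢v)))

  -- Vertices outside the list are coloured 0.
  colourings : List (Fin n) → List (Vector ℕ n)
  colourings []       = const 0 ∷ []
  colourings (v ∷ vs) = concatMap (λ ψ → map (λ c → ψ [ v ↦ c ]) (L La v)) (colourings vs)

  ∑-colourings-∷ : ∀ v vs (g : Vector ℕ n → ℕ) →
                   ∑ (colourings (v ∷ vs)) g ≡ (∑[ ψ ∈ colourings vs ] ∑[ c ∈ L La v ] g (ψ [ v ↦ c ]))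
  ∑-colourings-∷ v vs g = trans (∑-concatMap g _ (colourings vs))
                                (∑-cong (λ ψ → ∑-map g (λ c → ψ [ v ↦ c ]) (L La v)) (colourings vs))

  ∑-colourings-↭ : ∀ {xs ys} (g : Vector ℕ n → ℕ) → Congruent _≗_ _≡_ g → xs ↭ ys →
                   ∑ (colourings xs) g ≡ ∑ (colourings ys) g
  ∑-colourings-↭ g g-cong ↭.refl = refl
  ∑-colourings-↭ {v ∷ xs} {v ∷ ys} g g-cong (↭.prep v xs↭ys) = begin
    ∑ (colourings (v ∷ xs)) g                      ≡⟨ ∑-colourings-∷ v xs g ⟩
    (∑[ ψ ∈ colourings xs ] ∑[ c ∈ L La v ] g (ψ [ v ↦ c ])) ≡⟨ ∑-colourings-↭ _ g⁺-cong xs↭ys ⟩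
    (∑[ ψ ∈ colourings ys ] ∑[ c ∈ L La v ] g (ψ [ v ↦ c ])) ≡⟨ ∑-colourings-∷ v ys g ⟨
    ∑ (colourings (v ∷ ys)) g                      ∎
    where
    open ≡-Reasoning
    g⁺-cong : Congruent _≗_ _≡_ (λ ψ → ∑[ c ∈ L La v ] g (ψ [ v ↦ c ]))
    g⁺-cong φ≗ψ = ∑-cong (λ c → g-cong (↦-cong v c φ≗ψ)) (L La v)
  ∑-colourings-↭ {x ∷ y ∷ xs} {y ∷ x ∷ ys} g g-cong (↭.swap x y xs↭ys) = begin
    ∑ (colourings (x ∷ y ∷ xs)) g                                   ≡⟨ unfold x y xs ⟩
    (∑[ ψ ∈ colourings xs ] ∑[ d ∈ L La y ] ∑[ c ∈ L La x ] g (ψ [ y ↦ d ] [ x ↦ c ]))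
      ≡⟨ ∑-cong reorder (colourings xs) ⟩
    (∑[ ψ ∈ colourings xs ] ∑[ c ∈ L La x ] ∑[ d ∈ L La y ] g (ψ [ x ↦ c ] [ y ↦ d ]))
      ≡⟨ ∑-colourings-↭ _ g⁺⁺-cong xs↭ys ⟩
    (∑[ ψ ∈ colourings ys ] ∑[ c ∈ L La x ] ∑[ d ∈ L La y ] g (ψ [ x ↦ c ] [ y ↦ d ]))
      ≡⟨ unfold y x ys ⟨
    ∑ (colourings (y ∷ x ∷ ys)) g                                   ∎
    where
    open ≡-Reasoning
    unfold : ∀ x y vs → ∑ (colourings (x ∷ y ∷ vs)) g ≡
             (∑[ ψ ∈ colourings vs ] ∑[ d ∈ L La y ] ∑[ c ∈ L La x ] g (ψ [ y ↦ d ] [ x ↦ c ]))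
    unfold x y vs = trans (∑-colourings-∷ x (y ∷ vs) g) (∑-colourings-∷ y vs _)
    reorder : ∀ ψ → (∑[ d ∈ L La y ] ∑[ c ∈ L La x ] g (ψ [ y ↦ d ] [ x ↦ c ]))
                  ≡ (∑[ c ∈ L La x ] ∑[ d ∈ L La y ] g (ψ [ x ↦ c ] [ y ↦ d ]))
    reorder ψ with x Fin.≟ y
    -- for x ≡ y the two sides differ only in the names of the bound colours
    ... | yes refl = refl
    ... | no x≢y   = trans (∑-comm _ (L La y) (L La x))
                           (∑-cong (λ c → ∑-cong (λ d → g-cong (updateAt-commutes x y x≢y ψ)) (L La y)) (L La x))
    g⁺⁺-cong : Congruent _≗_ _≡_ (λ ψ → ∑[ c ∈ L La x ] ∑[ d ∈ L La y ] g (ψ [ x ↦ c ] [ y ↦ d ]))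
    g⁺⁺-cong φ≗ψ = ∑-cong (λ c → ∑-cong (λ d → g-cong (↦-cong y d (↦-cong x c φ≗ψ))) (L La y)) (L La x)
  ∑-colourings-↭ g g-cong (↭.trans xs↭ys ys↭zs) =
    trans (∑-colourings-↭ g g-cong xs↭ys) (∑-colourings-↭ g g-cong ys↭zs)

  All-colourings-∷ : ∀ {P Q : Vector ℕ n → Set} {v vs} → (∀ {ψ c} → P ψ → c ∈ L La v → Q (ψ [ v ↦ c ])) →
                     All P (colourings vs) → All Q (colourings (v ∷ vs))
  All-colourings-∷ extend all = Allₚ.concat⁺ (Allₚ.map⁺ (All.map (λ Pψ → Allₚ.map⁺ (All.tabulate (extend Pψ))) all))

  colourings-∈L : ∀ vs → All (λ χ → ∀ {u} → u ∈ vs → χ u ∈ L La u) (colourings vs)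
  colourings-∈L []       = (λ ()) ∷ []
  colourings-∈L (v ∷ vs) = All-colourings-∷ {vs = vs} extend (colourings-∈L vs)
    where
    extend : ∀ {ψ c} → (∀ {u} → u ∈ vs → ψ u ∈ L La u) → c ∈ L La v → ∀ {u} → u ∈ v ∷ vs → (ψ [ v ↦ c ]) u ∈ L La u
    extend {ψ} {c} ψ∈L c∈L {u} u∈ with u Fin.≟ v | u∈
    ... | yes refl | _             = subst (_∈ L La u) (sym (updateAt-updates u ψ)) c∈L
    ... | no u≢v   | here u≡v      = ⊥-elim (u≢v u≡v)
    ... | no u≢v   | there u∈vs    = subst (_∈ L La u) (sym (updateAt-minimal u v ψ u≢v)) (ψ∈L u∈vs)

  colourings-vanish : ∀ vs → All (λ χ → ∀ {u} → u ∉ vs → χ u ≡ 0) (colourings vs)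
  colourings-vanish []       = (λ _ → refl) ∷ []
  colourings-vanish (v ∷ vs) = All-colourings-∷ {vs = vs} extend (colourings-vanish vs)
    where
    extend : ∀ {ψ c} → (∀ {u} → u ∉ vs → ψ u ≡ 0) → c ∈ L La v → ∀ {u} → u ∉ v ∷ vs → (ψ [ v ↦ c ]) u ≡ 0
    extend {ψ} ψ≡0 _ {u} u∉ = trans (updateAt-minimal u v ψ (u∉ ∘ here)) (ψ≡0 (u∉ ∘ there))

  ↦-distinct : ∀ {ψ ψ′ v c c′} → ψ v ≡ ψ′ v → Distinct ψ ψ′ → Distinct (ψ [ v ↦ c ]) (ψ′ [ v ↦ c′ ])
  ↦-distinct {ψ} {ψ′} {v} ψv≡ψ′v ψ≉ψ′ eq = ψ≉ψ′ agree
    where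
    agree : ∀ x → ψ x ≡ ψ′ x
    agree x with x Fin.≟ v
    ... | yes refl = ψv≡ψ′v
    ... | no x≢v   = trans (sym (updateAt-minimal x v ψ x≢v)) (trans (eq x) (updateAt-minimal x v ψ′ x≢v))

  colourings-distinct : ∀ vs → Unique vs → AllPairs Distinct (colourings vs)
  colourings-distinct []       _                = [] ∷ []
  colourings-distinct (v ∷ vs) (v≢vs ∷ uniq) =
    extensions-distinct (colourings vs)
      (All.map (λ vanish → vanish (Uniqueₚ.Unique[x∷xs]⇒x∉xs (v≢vs ∷ uniq))) (colourings-vanish vs))
      (colourings-distinct vs uniq)
    where
    recolour : Vector ℕ n → List (Vector ℕ n)
    recolour ψ = map (λ c → ψ [ v ↦ c ]) (L La v)
    extensions-distinct : ∀ ψs → All (λ ψ → ψ v ≡ 0) ψs → AllPairs Distinct ψs →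
                          AllPairs Distinct (concatMap recolour ψs)
    extensions-distinct []       _                  _ = []
    extensions-distinct (ψ ∷ ψs) (ψv≡0 ∷ ψsv≡0) (ψ≉ψs ∷ ψs-distinct) =
      AllPairsₚ.++⁺ same-ψ (extensions-distinct ψs ψsv≡0 ψs-distinct) across
      where
      same-ψ : AllPairs Distinct (recolour ψ)
      same-ψ = AllPairsₚ.map⁺ (AllPairs.map (λ {c} {c′} c≢c′ eq →
                 c≢c′ (trans (sym (updateAt-updates v ψ)) (trans (eq v) (updateAt-updates v ψ)))) (unique La v))
      across : All (λ χ → All (Distinct χ) (concatMap recolour ψs)) (recolour ψ)
      across = Allₚ.map⁺ (All.tabulate (λ _ → Allₚ.concat⁺ (Allₚ.map⁺ (All.map
                 (λ (ψ′v≡0 , ψ≉ψ′) → Allₚ.map⁺ (All.tabulate (λ _ → ↦-distinct (trans ψv≡0 (sym ψ′v≡0)) ψ≉ψ′)))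
                 (All.zip (ψsv≡0 , ψ≉ψs))))))

module ProperColourings {n} (G : Graph n) (La : ListAssignment n) where
  open Colourings La
  open Neighbourhoods G
  open import Data.List.Membership.DecPropositional (Fin._≟_ {n}) using (_∈?_)

  ProperOn : List (Fin n) → Vector ℕ n → Set
  ProperOn vs φ = ∀ {u w} → u ∈ vs → w ∈ vs → adj G u w ≡ true → φ u ≢ φ w

  properOn? : ∀ vs φ → Dec (ProperOn vs φ)
  properOn? vs φ = map′ (λ p u∈ w∈ → All.lookup (All.lookup p u∈) w∈)
                        (λ p → All.tabulate (λ u∈ → All.tabulate (λ w∈ → p u∈ w∈)))
                        (All.all? (λ u → All.all? (λ w → (adj G u w Boolₚ.≟ true) →-dec ¬? (φ u ℕ.≟ φ w)) vs) vs)

  ProperOn-⊆ : ∀ {vs ws φ ψ} → (∀ {x} → x ∈ ws → x ∈ vs × φ x ≡ ψ x) → ProperOn vs φ → ProperOn ws ψ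
  ProperOn-⊆ ws⊆vs φ-proper u∈ w∈ uw eq with ws⊆vs u∈ | ws⊆vs w∈
  ... | u∈vs , φu≡ψu | w∈vs , φw≡ψw = φ-proper u∈vs w∈vs uw (trans φu≡ψu (trans eq (sym φw≡ψw)))

  ⟦properOn?⟧-cong : ∀ vs {φ ψ} → φ ≗ ψ → ⟦ properOn? vs φ ⟧ ≡ ⟦ properOn? vs ψ ⟧
  ⟦properOn?⟧-cong vs φ≗ψ = ⟦⟧-cong (ProperOn-⊆ (λ x∈ → x∈ , φ≗ψ _)) (ProperOn-⊆ (λ x∈ → x∈ , sym (φ≗ψ _)))
                                    (properOn? vs _) (properOn? vs _)

  #proper : List (Fin n) → ℕ
  #proper vs = ∑[ χ ∈ colourings vs ] ⟦ properOn? vs χ ⟧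

  #proper-↭ : ∀ {xs ys} → xs ↭ ys → #proper xs ≡ #proper ys
  #proper-↭ {xs} {ys} xs↭ys =
    trans (∑-colourings-↭ _ (⟦properOn?⟧-cong xs) xs↭ys)
          (∑-cong (λ χ → ⟦⟧-cong (ProperOn-⊆ (λ x∈ys → Permₚ.∈-resp-↭ (↭.↭-sym xs↭ys) x∈ys , refl))
                                 (ProperOn-⊆ (λ x∈xs → Permₚ.∈-resp-↭ xs↭ys x∈xs , refl))
                                 (properOn? xs χ) (properOn? ys χ))
                  (colourings ys))

  _∖_ : List (Fin n) → Fin n → List (Fin n)
  ws ∖ u = filter (λ x → ¬? (u Fin.≟ x)) ws

  ∈-∖⁻ : ∀ {x ws u} → x ∈ ws ∖ u → x ∈ ws × u ≢ x
  ∈-∖⁻ {ws = ws} {u} = Membershipₚ.∈-filter⁻ (λ x → ¬? (u Fin.≟ x)) {xs = ws}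

  ↭-∖ : ∀ {ws u} → Unique ws → u ∈ ws → ws ↭ u ∷ ws ∖ u
  ↭-∖ {u ∷ ws} {u} (u∉ws ∷ _) (here refl) = begin
    u ∷ ws     ≡⟨ cong (u ∷_) (Listₚ.filter-all (λ x → ¬? (u Fin.≟ x)) u∉ws) ⟨
    u ∷ ws ∖ u ≡⟨ cong (u ∷_) (Listₚ.filter-reject (λ x → ¬? (u Fin.≟ x)) (λ u≢u → u≢u refl)) ⟨
    u ∷ (u ∷ ws) ∖ u ∎
    where open ↭.PermutationReasoning
  ↭-∖ {x ∷ ws} {u} (x∉ws ∷ uniq) (there u∈ws) = begin
    x ∷ ws           <⟨ ↭-∖ uniq u∈ws ⟩
    x ∷ u ∷ ws ∖ u   ↭⟨ ↭.swap x u ↭.refl ⟩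
    u ∷ x ∷ ws ∖ u   ≡⟨ cong (u ∷_) (Listₚ.filter-accept (λ x → ¬? (u Fin.≟ x)) u≢x) ⟨
    u ∷ (x ∷ ws) ∖ u ∎
    where
    open ↭.PermutationReasoning
    u≢x : u ≢ x
    u≢x u≡x = All.lookup x∉ws u∈ws (sym u≡x)

  Unique-∖ : ∀ {ws} u → Unique ws → Unique (u ∷ ws ∖ u)
  Unique-∖ {ws} u uniq = Allₚ.all-filter (λ x → ¬? (u Fin.≟ x)) ws ∷ Uniqueₚ.filter⁺ (λ x → ¬? (u Fin.≟ x)) uniq

  no-loops : ∀ {v} → adj G v v ≢ true
  no-loops {v} vv with () ← trans (sym vv) (irrefl G v)

  ProperOn-extend : ∀ {ws v χ c} → v ∉ ws → ProperOn ws χ →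
                    (∀ {u} → u ∈ ws → adj G v u ≡ true → χ u ≢ c) → ProperOn (v ∷ ws) (χ [ v ↦ c ])
  ProperOn-extend {ws} {v} {χ} {c} v∉ws χ-proper no-clash = proper
    where
    agree : ∀ {x} → x ∈ ws → (χ [ v ↦ c ]) x ≡ χ x
    agree {x} x∈ws = updateAt-minimal x v χ (λ { refl → v∉ws x∈ws })
    proper : ProperOn (v ∷ ws) (χ [ v ↦ c ])
    proper (here refl) (here refl) vv _    = no-loops vv
    proper (here refl) (there w∈)  vw eq   =
      no-clash w∈ vw (trans (sym (agree w∈)) (trans (sym eq) (updateAt-updates v χ)))
    proper (there u∈)  (here refl) uv eq   =
      no-clash u∈ (trans (Graph.sym G _ _) uv) (trans (sym (agree u∈)) (trans eq (updateAt-updates v χ)))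
    proper (there u∈)  (there w∈)  uw eq   =
      χ-proper u∈ w∈ uw (trans (sym (agree u∈)) (trans eq (agree w∈)))

  #properWith : List (Fin n) → Fin n → ℕ → ℕ
  #properWith ws u c = ∑[ χ ∈ colourings ws ] ⟦ properOn? ws χ ⟧ * ⟦ χ u ℕ.≟ c ⟧

  proper-≤-extension+clashes : ∀ {ws v} → v ∉ ws → ∀ χ c →
    ⟦ properOn? ws χ ⟧ ≤ ⟦ properOn? (v ∷ ws) (χ [ v ↦ c ]) ⟧ +
                        ∑Nbrs v (λ u → ⟦ u ∈? ws ⟧ * (⟦ properOn? ws χ ⟧ * ⟦ χ u ℕ.≟ c ⟧))
  proper-≤-extension+clashes {ws} {v} v∉ws χ c with properOn? ws χ
  ... | no _ = z≤n
  ... | yes χ-proper with properOn? (v ∷ ws) (χ [ v ↦ c ])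
  ...   | yes _ = s≤s z≤n
  ...   | no ¬extension-proper with Finₚ.any? (λ u → (adj G v u Boolₚ.≟ true) ×-dec ((u ∈? ws) ×-dec (χ u ℕ.≟ c)))
  ...     | yes (u , vu , u∈ws , χu≡c) =
    -- the first `with` has already turned ⟦ properOn? ws χ ⟧ into 1 in the goal
    ℕₚ.≤-trans (ℕₚ.≤-reflexive (sym clash)) (∑Nbrs-≥ (λ u → ⟦ u ∈? ws ⟧ * (1 * ⟦ χ u ℕ.≟ c ⟧)) vu)
    where
    clash : ⟦ u ∈? ws ⟧ * (1 * ⟦ χ u ℕ.≟ c ⟧) ≡ 1
    clash = cong₂ _*_ (⟦⟧-yes (u ∈? ws) u∈ws) (cong (1 *_) (⟦⟧-yes (χ u ℕ.≟ c) χu≡c))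
  ...     | no no-clash =
    ⊥-elim (¬extension-proper (ProperOn-extend v∉ws χ-proper (λ u∈ws vu χu≡c → no-clash (_ , vu , u∈ws , χu≡c))))

  extension-count : ∀ {ws v} → v ∉ ws →
    card (L La v) * #proper ws ≤
    #proper (v ∷ ws) + ∑Nbrs v (λ u → ⟦ u ∈? ws ⟧ * (∑[ c ∈ L La v ] #properWith ws u c))
  extension-count {ws} {v} v∉ws = begin
    card (L La v) * #proper ws                            ≡⟨ ∑-*ˡ (card (L La v)) proper C ⟨
    (∑[ χ ∈ C ] card (L La v) * proper χ)                 ≡⟨ ∑-cong (λ χ → ∑-const (proper χ) (L La v)) C ⟨
    (∑[ χ ∈ C ] ∑[ c ∈ L La v ] proper χ)
      ≤⟨ ∑-mono (λ χ → ∑-mono (proper-≤-extension+clashes v∉ws χ) (L La v)) C ⟩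
    (∑[ χ ∈ C ] ∑[ c ∈ L La v ] extension χ c + clashes χ c)
      ≡⟨ trans (∑-cong (λ χ → ∑-+ (extension χ) (clashes χ) (L La v)) C) (∑-+ _ _ C) ⟩
    (∑[ χ ∈ C ] ∑[ c ∈ L La v ] extension χ c) + (∑[ χ ∈ C ] ∑[ c ∈ L La v ] clashes χ c)
      ≡⟨ cong₂ _+_ (sym (∑-colourings-∷ v ws _)) regroup ⟩
    #proper (v ∷ ws) + ∑Nbrs v (λ u → ⟦ u ∈? ws ⟧ * (∑[ c ∈ L La v ] #properWith ws u c)) ∎
    where
    open ℕₚ.≤-Reasoning
    C : List (Vector ℕ n)
    C = colourings ws
    proper : Vector ℕ n → ℕ
    proper χ = ⟦ properOn? ws χ ⟧
    extension : Vector ℕ n → ℕ → ℕ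
    extension χ c = ⟦ properOn? (v ∷ ws) (χ [ v ↦ c ]) ⟧
    clash : Vector ℕ n → ℕ → Fin n → ℕ
    clash χ c u = ⟦ u ∈? ws ⟧ * (proper χ * ⟦ χ u ℕ.≟ c ⟧)
    clashes : Vector ℕ n → ℕ → ℕ
    clashes χ c = ∑Nbrs v (clash χ c)
    regroup-at : ∀ u → (∑[ χ ∈ C ] ∑[ c ∈ L La v ] clash χ c u) ≡ ⟦ u ∈? ws ⟧ * (∑[ c ∈ L La v ] #properWith ws u c)
    regroup-at u = begin-equality
      (∑[ χ ∈ C ] ∑[ c ∈ L La v ] clash χ c u)
        ≡⟨ ∑-cong (λ χ → ∑-*ˡ ⟦ u ∈? ws ⟧ _ (L La v)) C ⟩
      (∑[ χ ∈ C ] ⟦ u ∈? ws ⟧ * (∑[ c ∈ L La v ] proper χ * ⟦ χ u ℕ.≟ c ⟧))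
        ≡⟨ ∑-*ˡ ⟦ u ∈? ws ⟧ _ C ⟩
      ⟦ u ∈? ws ⟧ * (∑[ χ ∈ C ] ∑[ c ∈ L La v ] proper χ * ⟦ χ u ℕ.≟ c ⟧)
        ≡⟨ cong (⟦ u ∈? ws ⟧ *_) (∑-comm (λ χ c → proper χ * ⟦ χ u ℕ.≟ c ⟧) C (L La v)) ⟩
      ⟦ u ∈? ws ⟧ * (∑[ c ∈ L La v ] #properWith ws u c) ∎
    regroup : (∑[ χ ∈ C ] ∑[ c ∈ L La v ] clashes χ c) ≡
              ∑Nbrs v (λ u → ⟦ u ∈? ws ⟧ * (∑[ c ∈ L La v ] #properWith ws u c))
    regroup = trans (∑-cong (λ χ → ∑-∑Nbrs v (clash χ) (L La v)) C)
                    (trans (∑-∑Nbrs v (λ χ u → ∑[ c ∈ L La v ] clash χ c u) C) (∑Nbrs-cong v regroup-at))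

  #properWith-≤ : ∀ {ws u} → Unique ws → u ∈ ws → ∀ c →
                  #properWith ws u c ≤ #proper (ws ∖ u) * (∑[ d ∈ L La u ] ⟦ d ℕ.≟ c ⟧)
  #properWith-≤ {ws} {u} uniq u∈ws c = begin
    #properWith ws u c                                  ≡⟨ ∑-colourings-↭ g g-cong (↭-∖ uniq u∈ws) ⟩
    ∑ (colourings (u ∷ ws ∖ u)) g                       ≡⟨ ∑-colourings-∷ u (ws ∖ u) g ⟩
    (∑[ ψ ∈ C ] ∑[ d ∈ L La u ] g (ψ [ u ↦ d ]))
      ≤⟨ ∑-mono (λ ψ → ∑-mono (restrict ψ) (L La u)) C ⟩
    (∑[ ψ ∈ C ] ∑[ d ∈ L La u ] ⟦ properOn? (ws ∖ u) ψ ⟧ * ⟦ d ℕ.≟ c ⟧)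
      ≡⟨ ∑-cong (λ ψ → ∑-*ˡ ⟦ properOn? (ws ∖ u) ψ ⟧ _ (L La u)) C ⟩
    (∑[ ψ ∈ C ] ⟦ properOn? (ws ∖ u) ψ ⟧ * (∑[ d ∈ L La u ] ⟦ d ℕ.≟ c ⟧))
      ≡⟨ ∑-*ʳ _ (λ ψ → ⟦ properOn? (ws ∖ u) ψ ⟧) C ⟩
    #proper (ws ∖ u) * (∑[ d ∈ L La u ] ⟦ d ℕ.≟ c ⟧)     ∎
    where
    open ℕₚ.≤-Reasoning
    C : List (Vector ℕ n)
    C = colourings (ws ∖ u)
    g : Vector ℕ n → ℕ
    g χ = ⟦ properOn? ws χ ⟧ * ⟦ χ u ℕ.≟ c ⟧
    g-cong : Congruent _≗_ _≡_ g
    g-cong χ≗χ′ = cong₂ _*_ (⟦properOn?⟧-cong ws χ≗χ′)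
                            (⟦⟧-cong (trans (sym (χ≗χ′ u))) (trans (χ≗χ′ u)) (_ ℕ.≟ c) (_ ℕ.≟ c))
    restrict : ∀ ψ d → g (ψ [ u ↦ d ]) ≤ ⟦ properOn? (ws ∖ u) ψ ⟧ * ⟦ d ℕ.≟ c ⟧
    restrict ψ d = ℕₚ.*-mono-≤ (⟦⟧-mono (ProperOn-⊆ agree) (properOn? ws _) (properOn? (ws ∖ u) ψ))
                              (ℕₚ.≤-reflexive (⟦⟧-cong (trans (sym ψ[u↦d]u≡d)) (trans ψ[u↦d]u≡d) (_ ℕ.≟ c) (d ℕ.≟ c)))
      where
      ψ[u↦d]u≡d : (ψ [ u ↦ d ]) u ≡ d
      ψ[u↦d]u≡d = updateAt-updates u ψ
      agree : ∀ {x} → x ∈ ws ∖ u → x ∈ ws × (ψ [ u ↦ d ]) x ≡ ψ x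
      agree x∈ with x∈ws , u≢x ← ∈-∖⁻ x∈ = x∈ws , updateAt-minimal _ u ψ (u≢x ∘ sym)

  clash-count : ∀ {ws u} v → Unique ws → u ∈ ws →
                (∑[ c ∈ L La v ] #properWith ws u c) ≤ #proper (ws ∖ u) * card∩ (L La v) (L La u)
  clash-count {ws} {u} v uniq u∈ws = begin
    (∑[ c ∈ L La v ] #properWith ws u c)
      ≤⟨ ∑-mono (#properWith-≤ uniq u∈ws) (L La v) ⟩
    (∑[ c ∈ L La v ] #proper (ws ∖ u) * (∑[ d ∈ L La u ] ⟦ d ℕ.≟ c ⟧))
      ≡⟨ ∑-*ˡ (#proper (ws ∖ u)) _ (L La v) ⟩
    #proper (ws ∖ u) * (∑[ c ∈ L La v ] ∑[ d ∈ L La u ] ⟦ d ℕ.≟ c ⟧)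
      ≡⟨ cong (#proper (ws ∖ u) *_) (card∩-∑ (L La v) (unique La u)) ⟨
    #proper (ws ∖ u) * card∩ (L La v) (L La u)
      ∎
    where open ℕₚ.≤-Reasoning

module DensityBound {n} (G : Graph n) (La : ListAssignment n)
  (condition : ∀ v → fromℕ 4 ℚ.* sumNbrs G v (λ w → frac (card∩ (L La v) (L La w)) (card (L La w)))
                     ℚ.≤ fromℕ (card (L La v))) where
  open Colourings La
  open Neighbourhoods G
  open ProperColourings G La
  open import Data.List.Membership.DecPropositional (Fin._≟_ {n}) using (_∈?_)

  card≢0 : ∀ u → card (L La u) ≢ 0
  card≢0 u with L La u | nonempty La u
  ... | []    | L≢[] = λ _ → L≢[] refl
  ... | _ ∷ _ | _    = λ ()

  extension-step : ∀ {ws v} → Unique (v ∷ ws) →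
    (∀ {u} → u ∈ ws → card (L La u) * #proper (ws ∖ u) ≤ 2 * #proper ws) →
    card (L La v) * #proper ws ≤ 2 * #proper (v ∷ ws)
  extension-step {ws} {v} (v≢ws ∷ uniq) ih =
    a≤p+b∧2b≤a⇒a≤2p (l * X) (#proper (v ∷ ws)) (∑Nbrs v t) counted clashes-bound
    where
    l X : ℕ
    l = card (L La v)
    X = #proper ws
    t : Fin n → ℕ
    t u = ⟦ u ∈? ws ⟧ * (#proper (ws ∖ u) * card∩ (L La v) (L La u))
    counted : l * X ≤ #proper (v ∷ ws) + ∑Nbrs v t
    counted = ℕₚ.≤-trans (extension-count (Uniqueₚ.Unique[x∷xs]⇒x∉xs (v≢ws ∷ uniq)))
      (ℕₚ.+-monoʳ-≤ (#proper (v ∷ ws)) (∑Nbrs-mono v (λ u _ → ⟦⟧-*-mono (clash-count v uniq) (u ∈? ws))))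
    weighted : ∀ u → t u * card (L La u) ≤ 2 * X * card∩ (L La v) (L La u)
    weighted u = subst (_≤ 2 * X * card∩ (L La v) (L La u)) (sym (ℕₚ.*-assoc ⟦ u ∈? ws ⟧ _ _))
      (⟦⟧-*-≤ (λ u∈ws → mp≤y⇒pam≤ya (card (L La u)) (#proper (ws ∖ u)) (card∩ (L La v) (L La u)) (ih u∈ws)) (u ∈? ws))
    4t≤2Xl : 4 * ∑Nbrs v t ≤ 2 * X * l
    4t≤2Xl = ∑Nbrs-bound v t (λ w → frac (card∩ (L La v) (L La w)) (card (L La w))) {4} {2 * X} {l}
      (λ u _ → fromℕ-≤-*frac (t u) (card∩ (L La v) (L La u)) (card (L La u)) (2 * X) (card≢0 u) (weighted u))
      (condition v)
    clashes-bound : 2 * ∑Nbrs v t ≤ l * X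
    clashes-bound = ℕₚ.*-cancelˡ-≤ 2 (subst₂ _≤_ (ℕₚ.*-assoc 2 2 (∑Nbrs v t))
                                                  (trans (ℕₚ.*-assoc 2 X l) (cong (2 *_) (ℕₚ.*-comm X l))) 4t≤2Xl)

  extension-bound : ∀ ws v → Unique (v ∷ ws) → card (L La v) * #proper ws ≤ 2 * #proper (v ∷ ws)
  extension-bound ws = bounded (length ws) ws ℕₚ.≤-refl
    where
    bounded : ∀ k ws → length ws ≤ k → ∀ v → Unique (v ∷ ws) → card (L La v) * #proper ws ≤ 2 * #proper (v ∷ ws)
    bounded zero    []       _   v uniq = extension-step uniq (λ ())
    bounded (suc k) ws       len v uniq@(_ ∷ ws-uniq) = extension-step uniq ih
      where
      ih : ∀ {u} → u ∈ ws → card (L La u) * #proper (ws ∖ u) ≤ 2 * #proper ws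
      ih {u} u∈ws = subst (λ m → card (L La u) * #proper (ws ∖ u) ≤ 2 * m) (sym (#proper-↭ ws↭))
                          (bounded k (ws ∖ u) shorter u (Unique-∖ u ws-uniq))
        where
        ws↭ : ws ↭ u ∷ ws ∖ u
        ws↭ = ↭-∖ ws-uniq u∈ws
        shorter : length (ws ∖ u) ≤ k
        shorter = ℕₚ.≤-pred (subst (_≤ suc k) (Permₚ.↭-length ws↭) len)

  product-bound : ∀ vs → Unique vs →
                  foldr (λ v acc → frac (card (L La v)) 2 ℚ.* acc) 1ℚ vs ℚ.≤ fromℕ (#proper vs)
  product-bound []       _                         = ℚₚ.≤-refl
  product-bound (v ∷ vs) uniq@(_ ∷ vs-uniq) = ℚₚ.≤-trans
    (ℚₚ.*-monoˡ-≤-nonNeg (frac l 2) {{ℚₚ.normalize-nonNeg l 2}} (product-bound vs vs-uniq))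
    (frac/2-*-≤ l (#proper vs) (#proper (v ∷ vs)) (extension-bound vs v uniq))
    where
    l : ℕ
    l = card (L La v)

theorem15 : (n : ℕ) (G : Graph n) (La : ListAssignment n) →
    (∀ v → (+ 4 / 1) ℚ.* sumNbrs G v (λ w → frac (card∩ (L La v) (L La w)) (card (L La w)))
    ℚ.≤ (+ card (L La v) / 1)) →
    Σ (List (Fin n → ℕ)) λ cs →
    All (λ φ → IsLColouring La φ × IsProper G φ) cs × AllPairs Distinct cs
    × prodV (λ v → frac (card (L La v)) 2) ℚ.≤ (+ length cs / 1)
theorem15 n G La condition = properColourings , All.zip (coloured , proper) , distinct , counted
  where
  open Colourings La
  open ProperColourings G La
  open DensityBound G La condition
  properColourings : List (Vector ℕ n)
  properColourings = filter (properOn? (allFin n)) (colourings (allFin n))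
  coloured : All (IsLColouring La) properColourings
  coloured = Allₚ.filter⁺ (properOn? (allFin n))
               (All.map (λ ∈L v → ∈L (Membershipₚ.∈-allFin v)) (colourings-∈L (allFin n)))
  proper : All (IsProper G) properColourings
  proper = All.map (λ χ-proper v w vw → χ-proper (Membershipₚ.∈-allFin v) (Membershipₚ.∈-allFin w) vw)
                   (Allₚ.all-filter (properOn? (allFin n)) (colourings (allFin n)))
  distinct : AllPairs Distinct properColourings
  distinct = AllPairsₚ.filter⁺ (properOn? (allFin n)) (colourings-distinct (allFin n) (Uniqueₚ.allFin⁺ n))
  counted : prodV (λ v → frac (card (L La v)) 2) ℚ.≤ fromℕ (length properColourings)
  counted = subst (λ k → prodV (λ v → frac (card (L La v)) 2) ℚ.≤ fromℕ k)
                  (sym (length-filter (properOn? (allFin n)) (colourings (allFin n))))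
                  (product-bound (allFin n) (Uniqueₚ.allFin⁺ n))
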